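{- Let $G=(V,E)$ be a graph on $n$ vertices, let $k$ be an integer with $0 \le k \le n$, and let $T \subseteq V$ be nonempty. Then $$(k + 1)\bigl(E_{k + 1}^T - E_k^T\bigr) = \sum_{S \subseteq V,\ S \supsetneq T} E_k^S\, D(S:T) - \bigl(2k + 1 + |N(T)| - n\bigr)E_k^T.$$
   Context: All graphs are finite, undirected and simple. For $S \subseteq V$, the (closed) neighborhood $N(S)$ is the set of vertices that are in $S$ or adjacent to a vertex of $S$, and $|N(T)|$ denotes its cardinality. A set $U$ dominates a set $W$ if $W \subseteq N(U)$, and dominates a vertex $w$ if $w \in N(U)$; a vertex $v$ dominates a set or vertex if $\{v\}$ does. For $S \subseteq V$ and integer $j\ge 0$, $E_j^S$ is the number of $j$-element subsets $U \subseteq V$ that dominate $V \setminus S$ but dominate no vertex of $S$ (it is $0$ if $j>n$). For $T \subseteq S \subseteq V$, $D(S:T)$ is the number of vertices $v \in V$ that dominate $S \setminus T$ but dominate no vertex of $T$. -}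

module Defs where

open import Data.Bool using (Bool; true; false; _∧_; _∨_; not; if_then_else_)
open import Data.Nat using (ℕ; zero; suc; _≡ᵇ_)
open import Data.Fin using (Fin; _≟_)
open import Data.Fin.Subset using (Subset; inside; outside; ∣_∣)
open import Data.Vec using (Vec; []; _∷_; lookup)
open import Data.List using (List; []; _∷_; _++_; map; length; filterᵇ; allFin; foldr)
open import Data.Bool.ListAction using (any; all)
open import Data.Integer using (ℤ)
open import Relation.Nullary.Decidable using (⌊_⌋)
open import Relation.Binary.PropositionalEquality using (_≡_)

record Graph (n : ℕ) : Set where
  field
    adj       : Fin n → Fin n → Bool
    symmetric : ∀ u v → adj u v ≡ adj v u
    irreflex  : ∀ v → adj v v ≡ false
open Graph public

module _ {n : ℕ} (G : Graph n) where

  closedAdj : Fin n → Fin n → Bool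
  closedAdj u w = ⌊ u ≟ w ⌋ ∨ adj G u w

  domV : Subset n → Fin n → Bool
  domV U w = any (λ u → lookup U u ∧ closedAdj u w) (allFin n)

  domS : Subset n → Subset n → Bool
  domS U W = all (λ w → not (lookup W w) ∨ domV U w) (allFin n)

  domNone : Subset n → Subset n → Bool
  domNone U S = all (λ w → not (lookup S w) ∨ not (domV U w)) (allFin n)

  N : Subset n → Subset n
  N S = Data.Vec.tabulate (domV S)
    where import Data.Vec

allSubsets : (n : ℕ) → List (Subset n)
allSubsets zero    = [] ∷ []
allSubsets (suc n) = map (inside ∷_) (allSubsets n) ++ map (outside ∷_) (allSubsets n)

compl : ∀ {n} → Subset n → Subset n
compl = Data.Vec.map not
  where import Data.Vec

minus : ∀ {n} → Subset n → Subset n → Subset n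
minus S T = Data.Vec.zipWith (λ a b → a ∧ not b) S T
  where import Data.Vec

subsetᵇ : ∀ {n} → Subset n → Subset n → Bool
subsetᵇ {n} T S = all (λ v → not (lookup T v) ∨ lookup S v) (allFin n)

properSubsetᵇ : ∀ {n} → Subset n → Subset n → Bool
properSubsetᵇ T S = subsetᵇ T S ∧ not (subsetᵇ S T)

singleton : ∀ {n} → Fin n → Subset n
singleton {n} v = Data.Vec.tabulate (λ u → ⌊ u ≟ v ⌋)
  where import Data.Vec

module _ {n : ℕ} (G : Graph n) where

  E : ℕ → Subset n → ℕ
  E j S = length (filterᵇ (λ U → (∣ U ∣ ≡ᵇ j) ∧ domS G U (compl S) ∧ domNone G U S) (allSubsets n))

  D : Subset n → Subset n → ℕ
  D S T = length (filterᵇ (λ v → domS G (singleton v) (minus S T) ∧ domNone G (singleton v) T) (allFin n))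

  sumOverSupersets : ℕ → Subset n → ℕ
  sumOverSupersets k T =
    foldr (λ S acc → E k S Data.Nat.* D S T Data.Nat.+ acc) 0
          (filterᵇ (λ S → properSubsetᵇ T S) (allSubsets n))
    where import Data.Nat

-- Write Ū = V ∖ N(U) for the set of vertices that U does not dominate; U is counted by E_j^S
-- exactly when |U| = j and S = Ū. Every term of the identity becomes a sum over k-sets U of a
-- sum over vertices v: (k+1)E_{k+1}^T counts the pairs (U, v) with v ∉ U and (U ∪ {v})‾ = T,
-- where (U ∪ {v})‾ = Ū ∖ N[v]; the sum over S ⊋ T collapses to [T ⊊ Ū] D(Ū : T); and |U|,
-- |N(T)| and n are sums over v of [v ∈ U], [N[v] meets T] and 1. Since Ū ∖ N[v] = Ū when
-- v ∈ U, the summands [v ∉ U][Ū ∖ N[v] = T] + [v ∈ U][Ū = T] add up to [Ū ∖ N[v] = T], and what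
-- remains is the identity, valid for arbitrary sets S, T, X and taken at S = Ū, X = N[v],
--   [S ∖ X = T] + [X ∩ T ≠ ∅][S = T] = [T ⊊ S][S ∖ T ⊆ X][X ∩ T = ∅] + [S = T].
module Submission where

open import Defs

open import Algebra.Bundles using (CommutativeMonoid)
open import Data.Bool using (Bool; true; false; _∧_; _∨_; not)
import Data.Bool.Base as Bool
import Data.Bool.Properties as Boolₚ
open import Algebra.Lattice.Properties.BooleanAlgebra Boolₚ.∨-∧-booleanAlgebra using (deMorgan₁; deMorgan₂)
import Algebra.Properties.CommutativeSemigroup (CommutativeMonoid.commutativeSemigroup Boolₚ.∧-commutativeMonoid) as ∧-CS
import Algebra.Properties.CommutativeSemigroup (CommutativeMonoid.commutativeSemigroup Boolₚ.∨-commutativeMonoid) as ∨-CS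
open import Data.Bool.ListAction using (and; or; all; any)
open import Data.Empty using (⊥-elim)
open import Data.Fin using (Fin; zero; suc; _≟_)
open import Data.Fin.Subset using (Subset; Nonempty; ∣_∣)
open import Data.Integer using (+_; _+_; _-_; _*_)
open import Data.Integer.Properties using (pos-+; pos-*)
open import Data.Integer.Solver using (module +-*-Solver)
open +-*-Solver using (solve; _:+_; _:*_; _:-_; _:=_; con)
open import Data.List using (List; []; _∷_; _++_; map; length; filterᵇ; allFin; foldr)
open import Data.List.Properties using (map-cong; map-tabulate; map-∘)
open import Data.List.Membership.Propositional using (lose)
open import Data.List.Membership.Propositional.Properties using (∈-allFin)
import Data.List.Relation.Unary.All as All
open import Data.List.Relation.Unary.All.Properties using (all⁺; all⁻)
import Data.List.Relation.Unary.Any as Any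
open import Data.List.Relation.Unary.Any.Properties using (any⁺; any⁻)
open import Data.Nat using (ℕ; zero; suc; _≤_; _≡ᵇ_) renaming (_+_ to _ℕ+_; _*_ to _ℕ*_)
import Data.Nat.Properties as ℕ
import Algebra.Properties.CommutativeSemigroup ℕ.+-commutativeSemigroup as +-CS
import Algebra.Properties.CommutativeSemigroup ℕ.*-commutativeSemigroup as *-CS
open import Data.Product using (∃; _,_)
open import Data.Vec using (Vec; []; _∷_; lookup; _[_]≔_)
import Data.Vec as Vec
import Data.Vec.Properties as Vecₚ
open import Function using (_∘_; id; Equivalence)
open import Relation.Nullary using (yes; no)
open import Relation.Nullary.Decidable using (⌊_⌋; toWitness; fromWitness)
open import Relation.Binary.PropositionalEquality using (_≡_; refl; sym; trans; cong; cong₂; subst; module ≡-Reasoning)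

private
  variable
    A B : Set

ι : Bool → ℕ
ι true  = 1
ι false = 0

ι-∧ : ∀ a b → ι (a ∧ b) ≡ ι a ℕ* ι b
ι-∧ true  b = sym (ℕ.*-identityˡ (ι b))
ι-∧ false b = refl

ι-≡ᵇ-subst : ∀ (f : ℕ → ℕ) m j → ι (m ≡ᵇ j) ℕ* f j ≡ ι (m ≡ᵇ j) ℕ* f m
ι-≡ᵇ-subst f m j with m ≡ᵇ j in m≡ᵇj
... | true  = cong (λ i → 1 ℕ* f i) (sym (ℕ.≡ᵇ⇒≡ m j (Equivalence.from Boolₚ.T-≡ m≡ᵇj)))
... | false = refl

∑ : List A → (A → ℕ) → ℕ
∑ []       f = 0
∑ (x ∷ xs) f = f x ℕ+ ∑ xs f

syntax ∑ xs (λ x → e) = ∑[ x ∈ xs ] e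

∑-cong : ∀ (xs : List A) {f g : A → ℕ} → (∀ x → f x ≡ g x) → ∑ xs f ≡ ∑ xs g
∑-cong []       f≗g = refl
∑-cong (x ∷ xs) f≗g = cong₂ _ℕ+_ (f≗g x) (∑-cong xs f≗g)

∑-+ : ∀ (xs : List A) (f g : A → ℕ) → ∑[ x ∈ xs ] (f x ℕ+ g x) ≡ ∑ xs f ℕ+ ∑ xs g
∑-+ []       f g = refl
∑-+ (x ∷ xs) f g = begin
  f x ℕ+ g x ℕ+ ∑[ x ∈ xs ] (f x ℕ+ g x) ≡⟨ cong (f x ℕ+ g x ℕ+_) (∑-+ xs f g) ⟩
  f x ℕ+ g x ℕ+ (∑ xs f ℕ+ ∑ xs g)       ≡⟨ +-CS.interchange (f x) (g x) (∑ xs f) (∑ xs g) ⟩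
  f x ℕ+ ∑ xs f ℕ+ (g x ℕ+ ∑ xs g)       ∎
  where open ≡-Reasoning

∑-*ˡ : ∀ (xs : List A) c (f : A → ℕ) → ∑[ x ∈ xs ] (c ℕ* f x) ≡ c ℕ* ∑ xs f
∑-*ˡ []       c f = sym (ℕ.*-zeroʳ c)
∑-*ˡ (x ∷ xs) c f =
  trans (cong (c ℕ* f x ℕ+_) (∑-*ˡ xs c f)) (sym (ℕ.*-distribˡ-+ c (f x) (∑ xs f)))

∑-*ʳ : ∀ (xs : List A) c (f : A → ℕ) → ∑[ x ∈ xs ] (f x ℕ* c) ≡ ∑ xs f ℕ* c
∑-*ʳ xs c f = begin
  ∑[ x ∈ xs ] (f x ℕ* c) ≡⟨ ∑-cong xs (λ x → ℕ.*-comm (f x) c) ⟩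
  ∑[ x ∈ xs ] (c ℕ* f x) ≡⟨ ∑-*ˡ xs c f ⟩
  c ℕ* ∑ xs f            ≡⟨ ℕ.*-comm c (∑ xs f) ⟩
  ∑ xs f ℕ* c            ∎
  where open ≡-Reasoning

∑-*-inner : ∀ (xs : List A) c (w f : A → ℕ) →
            c ℕ* ∑[ x ∈ xs ] (w x ℕ* f x) ≡ ∑[ x ∈ xs ] (w x ℕ* (c ℕ* f x))
∑-*-inner xs c w f = trans (sym (∑-*ˡ xs c _)) (∑-cong xs (λ x → *-CS.x∙yz≈y∙xz c (w x) (f x)))

∑-*-+ : ∀ (xs : List A) (w f g : A → ℕ) →
        ∑[ x ∈ xs ] (w x ℕ* f x) ℕ+ ∑[ x ∈ xs ] (w x ℕ* g x) ≡ ∑[ x ∈ xs ] (w x ℕ* (f x ℕ+ g x))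
∑-*-+ xs w f g = trans (sym (∑-+ xs _ _)) (∑-cong xs (λ x → sym (ℕ.*-distribˡ-+ (w x) (f x) (g x))))

∑-zero : ∀ (xs : List A) → ∑[ x ∈ xs ] 0 ≡ 0
∑-zero []       = refl
∑-zero (x ∷ xs) = ∑-zero xs

∑-comm : ∀ (xs : List A) (ys : List B) (f : A → B → ℕ) →
         ∑[ x ∈ xs ] ∑[ y ∈ ys ] f x y ≡ ∑[ y ∈ ys ] ∑[ x ∈ xs ] f x y
∑-comm []       ys f = sym (∑-zero ys)
∑-comm (x ∷ xs) ys f = trans (cong (∑ ys (f x) ℕ+_) (∑-comm xs ys f))
                             (sym (∑-+ ys (f x) (λ y → ∑[ x ∈ xs ] f x y)))

∑-++ : ∀ (xs ys : List A) (f : A → ℕ) → ∑ (xs ++ ys) f ≡ ∑ xs f ℕ+ ∑ ys f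
∑-++ []       ys f = refl
∑-++ (x ∷ xs) ys f = trans (cong (f x ℕ+_) (∑-++ xs ys f)) (sym (ℕ.+-assoc (f x) _ _))

∑-map : ∀ (g : A → B) (xs : List A) (f : B → ℕ) → ∑ (map g xs) f ≡ ∑ xs (f ∘ g)
∑-map g []       f = refl
∑-map g (x ∷ xs) f = cong (f (g x) ℕ+_) (∑-map g xs f)

allFin-suc : ∀ n → allFin (suc n) ≡ zero ∷ map suc (allFin n)
allFin-suc n = cong (zero ∷_) (sym (map-tabulate id suc))

∑-allFin-suc : ∀ n (f : Fin (suc n) → ℕ) → ∑ (allFin (suc n)) f ≡ f zero ℕ+ ∑ (allFin n) (f ∘ suc)
∑-allFin-suc n f =
  trans (cong (λ vs → ∑ vs f) (allFin-suc n)) (cong (f zero ℕ+_) (∑-map suc (allFin n) f))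

∑-allFin-const : ∀ n c → ∑[ v ∈ allFin n ] c ≡ n ℕ* c
∑-allFin-const zero    c = refl
∑-allFin-const (suc n) c = trans (∑-allFin-suc n (λ _ → c)) (cong (c ℕ+_) (∑-allFin-const n c))

length-filterᵇ : ∀ (p : A → Bool) xs → length (filterᵇ p xs) ≡ ∑[ x ∈ xs ] ι (p x)
length-filterᵇ p []       = refl
length-filterᵇ p (x ∷ xs) with p x
... | true  = cong suc (length-filterᵇ p xs)
... | false = length-filterᵇ p xs

foldr-+-filterᵇ : ∀ (p : A → Bool) (f : A → ℕ) xs →
                  foldr (λ x acc → f x ℕ+ acc) 0 (filterᵇ p xs) ≡ ∑[ x ∈ xs ] (ι (p x) ℕ* f x)
foldr-+-filterᵇ p f []       = refl
foldr-+-filterᵇ p f (x ∷ xs) with p x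
... | true  = cong₂ _ℕ+_ (sym (ℕ.+-identityʳ (f x))) (foldr-+-filterᵇ p f xs)
... | false = foldr-+-filterᵇ p f xs

all-cong : ∀ {p q : A → Bool} xs → (∀ x → p x ≡ q x) → all p xs ≡ all q xs
all-cong xs p≗q = cong and (map-cong p≗q xs)

any-cong : ∀ {p q : A → Bool} xs → (∀ x → p x ≡ q x) → any p xs ≡ any q xs
any-cong xs p≗q = cong or (map-cong p≗q xs)

all-∧ : ∀ (p q : A → Bool) xs → all (λ x → p x ∧ q x) xs ≡ all p xs ∧ all q xs
all-∧ p q []       = refl
all-∧ p q (x ∷ xs) =
  trans (cong ((p x ∧ q x) ∧_) (all-∧ p q xs)) (∧-CS.interchange (p x) (q x) (all p xs) (all q xs))

any-∨ : ∀ (p q : A → Bool) xs → any (λ x → p x ∨ q x) xs ≡ any p xs ∨ any q xs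
any-∨ p q []       = refl
any-∨ p q (x ∷ xs) =
  trans (cong ((p x ∨ q x) ∨_) (any-∨ p q xs)) (∨-CS.interchange (p x) (q x) (any p xs) (any q xs))

any≡not-all-not : ∀ (p : A → Bool) xs → any p xs ≡ not (all (not ∘ p) xs)
any≡not-all-not p []       = refl
any≡not-all-not p (x ∷ xs) with p x
... | true  = refl
... | false = any≡not-all-not p xs

all-mono : ∀ {p q : A → Bool} → (∀ x → Bool.T (p x) → Bool.T (q x)) →
           ∀ xs → Bool.T (all p xs) → Bool.T (all q xs)
all-mono p⇒q xs = all⁻ _ ∘ All.map (p⇒q _) ∘ all⁺ _ xs

all-allFin-suc : ∀ n (p : Fin (suc n) → Bool) → all p (allFin (suc n)) ≡ p zero ∧ all (p ∘ suc) (allFin n)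
all-allFin-suc n p =
  trans (cong (all p) (allFin-suc n)) (cong (λ bs → p zero ∧ and bs) (sym (map-∘ (allFin n))))

T-any-allFin⁻ : ∀ {n} (p : Fin n → Bool) → Bool.T (any p (allFin n)) → ∃ λ i → Bool.T (p i)
T-any-allFin⁻ {n} p = Any.satisfied ∘ any⁻ p (allFin n)

T-any-allFin⁺ : ∀ {n} (p : Fin n → Bool) i → Bool.T (p i) → Bool.T (any p (allFin n))
T-any-allFin⁺ p i = any⁺ p ∘ lose (∈-allFin i)

T-ext : ∀ {a b} → (Bool.T a → Bool.T b) → (Bool.T b → Bool.T a) → a ≡ b
T-ext {false} {false} a⇒b b⇒a = refl
T-ext {false} {true}  a⇒b b⇒a = ⊥-elim (b⇒a _)
T-ext {true}  {false} a⇒b b⇒a = ⊥-elim (a⇒b _)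
T-ext {true}  {true}  a⇒b b⇒a = refl

≡-from-lookup : ∀ {n} {xs ys : Vec A n} → (∀ i → lookup xs i ≡ lookup ys i) → xs ≡ ys
≡-from-lookup {xs = xs} {ys} xs≗ys = begin
  xs                 ≡⟨ sym (Vecₚ.tabulate∘lookup xs) ⟩
  Vec.tabulate (lookup xs) ≡⟨ Vecₚ.tabulate-cong xs≗ys ⟩
  Vec.tabulate (lookup ys) ≡⟨ Vecₚ.tabulate∘lookup ys ⟩
  ys                 ∎
  where open ≡-Reasoning

⌊≟⌋-sym : ∀ {n} (u w : Fin n) → ⌊ u ≟ w ⌋ ≡ ⌊ w ≟ u ⌋
⌊≟⌋-sym u w = T-ext (fromWitness ∘ sym ∘ toWitness) (fromWitness ∘ sym ∘ toWitness)

lookup-singleton : ∀ {n} (v u : Fin n) → lookup (singleton v) u ≡ ⌊ u ≟ v ⌋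
lookup-singleton v u = Vecₚ.lookup∘tabulate _ u

lookup-[]≔true : ∀ {n} (U : Subset n) v u → lookup (U [ v ]≔ true) u ≡ lookup U u ∨ lookup (singleton v) u
lookup-[]≔true U v u with u ≟ v in u≟v
... | yes refl = begin
  lookup (U [ u ]≔ true) u        ≡⟨ Vecₚ.lookup∘update u U true ⟩
  true                            ≡⟨ sym (Boolₚ.∨-zeroʳ (lookup U u)) ⟩
  lookup U u ∨ true               ≡⟨ cong (λ d → lookup U u ∨ ⌊ d ⌋) (sym u≟v) ⟩
  lookup U u ∨ ⌊ u ≟ u ⌋          ≡⟨ cong (lookup U u ∨_) (sym (lookup-singleton u u)) ⟩
  lookup U u ∨ lookup (singleton u) u ∎
  where open ≡-Reasoning
... | no u≢v = begin
  lookup (U [ v ]≔ true) u        ≡⟨ Vecₚ.lookup∘update′ u≢v U true ⟩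
  lookup U u                      ≡⟨ sym (Boolₚ.∨-identityʳ (lookup U u)) ⟩
  lookup U u ∨ false              ≡⟨ cong (λ d → lookup U u ∨ ⌊ d ⌋) (sym u≟v) ⟩
  lookup U u ∨ ⌊ u ≟ v ⌋          ≡⟨ cong (lookup U u ∨_) (sym (lookup-singleton v u)) ⟩
  lookup U u ∨ lookup (singleton v) u ∎
  where open ≡-Reasoning

lookup-minus : ∀ {n} (S X : Subset n) w → lookup (minus S X) w ≡ lookup S w ∧ not (lookup X w)
lookup-minus S X w = Vecₚ.lookup-zipWith _ w S X

lookup-compl : ∀ {n} (S : Subset n) w → lookup (compl S) w ≡ not (lookup S w)
lookup-compl S w = Vecₚ.lookup-map w not S

infix 4 _==_

_==_ : ∀ {n} → Subset n → Subset n → Bool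
_==_ {n} S R = all (λ w → ⌊ lookup S w Boolₚ.≟ lookup R w ⌋) (allFin n)

disjointᵇ : ∀ {n} → Subset n → Subset n → Bool
disjointᵇ {n} S X = all (λ w → not (lookup S w) ∨ not (lookup X w)) (allFin n)

==-∷ : ∀ {n} x y (S R : Subset n) → (x ∷ S == y ∷ R) ≡ ⌊ x Boolₚ.≟ y ⌋ ∧ (S == R)
==-∷ {n} x y S R = all-allFin-suc n _

∑-allSubsets-suc : ∀ n (f : Subset (suc n) → ℕ) →
  ∑ (allSubsets (suc n)) f ≡ ∑[ U ∈ allSubsets n ] f (true ∷ U) ℕ+ ∑[ U ∈ allSubsets n ] f (false ∷ U)
∑-allSubsets-suc n f = begin
  ∑ (map (true ∷_) (allSubsets n) ++ map (false ∷_) (allSubsets n)) f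
    ≡⟨ ∑-++ (map (true ∷_) (allSubsets n)) _ f ⟩
  ∑ (map (true ∷_) (allSubsets n)) f ℕ+ ∑ (map (false ∷_) (allSubsets n)) f
    ≡⟨ cong₂ _ℕ+_ (∑-map (true ∷_) (allSubsets n) f) (∑-map (false ∷_) (allSubsets n) f) ⟩
  ∑[ U ∈ allSubsets n ] f (true ∷ U) ℕ+ ∑[ U ∈ allSubsets n ] f (false ∷ U) ∎
  where open ≡-Reasoning

∑-allSubsets-== : ∀ n (X : Subset n) (h : Subset n → ℕ) → ∑[ S ∈ allSubsets n ] (ι (X == S) ℕ* h S) ≡ h X
∑-allSubsets-== zero    [] h = trans (ℕ.+-identityʳ _) (ℕ.*-identityˡ (h []))
∑-allSubsets-== (suc n) (x ∷ X) h = begin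
  ∑[ S ∈ allSubsets (suc n) ] (ι (x ∷ X == S) ℕ* h S)
    ≡⟨ ∑-allSubsets-suc n _ ⟩
  ∑[ S ∈ allSubsets n ] (ι (x ∷ X == true ∷ S) ℕ* h (true ∷ S))
    ℕ+ ∑[ S ∈ allSubsets n ] (ι (x ∷ X == false ∷ S) ℕ* h (false ∷ S))
    ≡⟨ cong₂ _ℕ+_ (∑-cong (allSubsets n) (λ S → cong (λ b → ι b ℕ* h (true ∷ S)) (==-∷ x true X S)))
                  (∑-cong (allSubsets n) (λ S → cong (λ b → ι b ℕ* h (false ∷ S)) (==-∷ x false X S))) ⟩
  ∑[ S ∈ allSubsets n ] (ι (⌊ x Boolₚ.≟ true ⌋ ∧ (X == S)) ℕ* h (true ∷ S))
    ℕ+ ∑[ S ∈ allSubsets n ] (ι (⌊ x Boolₚ.≟ false ⌋ ∧ (X == S)) ℕ* h (false ∷ S))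
    ≡⟨ pick x ⟩
  h (x ∷ X) ∎
  where
  open ≡-Reasoning
  pick : ∀ x → ∑[ S ∈ allSubsets n ] (ι (⌊ x Boolₚ.≟ true ⌋ ∧ (X == S)) ℕ* h (true ∷ S))
                 ℕ+ ∑[ S ∈ allSubsets n ] (ι (⌊ x Boolₚ.≟ false ⌋ ∧ (X == S)) ℕ* h (false ∷ S))
               ≡ h (x ∷ X)
  pick true  = trans (cong₂ _ℕ+_ (∑-allSubsets-== n X (h ∘ (true ∷_))) (∑-zero (allSubsets n)))
                     (ℕ.+-identityʳ _)
  pick false = cong₂ _ℕ+_ (∑-zero (allSubsets n)) (∑-allSubsets-== n X (h ∘ (false ∷_)))

∑-allSubsets-[]≔true : ∀ n (v : Fin n) (f : Subset n → ℕ) →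
  ∑[ U ∈ allSubsets n ] (ι (lookup U v) ℕ* f U)
    ≡ ∑[ U ∈ allSubsets n ] (ι (not (lookup U v)) ℕ* f (U [ v ]≔ true))
∑-allSubsets-[]≔true (suc n) v f = begin
  ∑[ U ∈ allSubsets (suc n) ] (ι (lookup U v) ℕ* f U)
    ≡⟨ ∑-allSubsets-suc n _ ⟩
  ∑[ U ∈ allSubsets n ] (ι (lookup (true ∷ U) v) ℕ* f (true ∷ U))
    ℕ+ ∑[ U ∈ allSubsets n ] (ι (lookup (false ∷ U) v) ℕ* f (false ∷ U))
    ≡⟨ by-position v ⟩
  ∑[ U ∈ allSubsets n ] (ι (not (lookup (true ∷ U) v)) ℕ* f ((true ∷ U) [ v ]≔ true))
    ℕ+ ∑[ U ∈ allSubsets n ] (ι (not (lookup (false ∷ U) v)) ℕ* f ((false ∷ U) [ v ]≔ true))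
    ≡⟨ sym (∑-allSubsets-suc n _) ⟩
  ∑[ U ∈ allSubsets (suc n) ] (ι (not (lookup U v)) ℕ* f (U [ v ]≔ true)) ∎
  where
  open ≡-Reasoning
  by-position : ∀ v →
    ∑[ U ∈ allSubsets n ] (ι (lookup (true ∷ U) v) ℕ* f (true ∷ U))
      ℕ+ ∑[ U ∈ allSubsets n ] (ι (lookup (false ∷ U) v) ℕ* f (false ∷ U))
    ≡ ∑[ U ∈ allSubsets n ] (ι (not (lookup (true ∷ U) v)) ℕ* f ((true ∷ U) [ v ]≔ true))
      ℕ+ ∑[ U ∈ allSubsets n ] (ι (not (lookup (false ∷ U) v)) ℕ* f ((false ∷ U) [ v ]≔ true))
  by-position zero    = begin
    Σ₁ ℕ+ ∑[ U ∈ allSubsets n ] 0 ≡⟨ cong (Σ₁ ℕ+_) (∑-zero (allSubsets n)) ⟩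
    Σ₁ ℕ+ 0                       ≡⟨ ℕ.+-comm Σ₁ 0 ⟩
    0 ℕ+ Σ₁                       ≡⟨ cong (_ℕ+ Σ₁) (∑-zero (allSubsets n)) ⟨
    ∑[ U ∈ allSubsets n ] 0 ℕ+ Σ₁ ∎
    where Σ₁ = ∑[ U ∈ allSubsets n ] (1 ℕ* f (true ∷ U))
  by-position (suc v) = cong₂ _ℕ+_ (∑-allSubsets-[]≔true n v (f ∘ (true ∷_)))
                                   (∑-allSubsets-[]≔true n v (f ∘ (false ∷_)))

∣∣≡∑ : ∀ {n} (U : Subset n) → ∣ U ∣ ≡ ∑[ v ∈ allFin n ] ι (lookup U v)
∣∣≡∑ []            = refl
∣∣≡∑ {suc n} (true ∷ U)  = trans (cong suc (∣∣≡∑ U)) (sym (∑-allFin-suc n (ι ∘ lookup (true ∷ U))))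
∣∣≡∑ {suc n} (false ∷ U) = trans (∣∣≡∑ U) (sym (∑-allFin-suc n (ι ∘ lookup (false ∷ U))))

∣[]≔true∣ : ∀ {n} (U : Subset n) v → lookup U v ≡ false → ∣ U [ v ]≔ true ∣ ≡ suc ∣ U ∣
∣[]≔true∣ (false ∷ U) zero    refl = refl
∣[]≔true∣ (true ∷ U)  (suc v) v∉U  = cong suc (∣[]≔true∣ U v v∉U)
∣[]≔true∣ (false ∷ U) (suc v) v∉U  = ∣[]≔true∣ U v v∉U

∑-card-suc : ∀ n k (g : Subset n → ℕ) →
  suc k ℕ* ∑[ U ∈ allSubsets n ] (ι (∣ U ∣ ≡ᵇ suc k) ℕ* g U)
    ≡ ∑[ U ∈ allSubsets n ] (ι (∣ U ∣ ≡ᵇ k) ℕ* ∑[ v ∈ allFin n ] (ι (not (lookup U v)) ℕ* g (U [ v ]≔ true)))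
∑-card-suc n k g = begin
  suc k ℕ* ∑[ U ∈ 𝒫 ] f U
    ≡⟨ ∑-*-inner 𝒫 (suc k) (λ U → ι (∣ U ∣ ≡ᵇ suc k)) g ⟩
  ∑[ U ∈ 𝒫 ] (ι (∣ U ∣ ≡ᵇ suc k) ℕ* (suc k ℕ* g U))
    ≡⟨ ∑-cong 𝒫 (λ U → ι-≡ᵇ-subst (_ℕ* g U) ∣ U ∣ (suc k)) ⟩
  ∑[ U ∈ 𝒫 ] (ι (∣ U ∣ ≡ᵇ suc k) ℕ* (∣ U ∣ ℕ* g U))
    ≡⟨ ∑-cong 𝒫 (λ U → *-CS.x∙yz≈y∙xz (ι (∣ U ∣ ≡ᵇ suc k)) ∣ U ∣ (g U)) ⟩
  ∑[ U ∈ 𝒫 ] (∣ U ∣ ℕ* f U)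
    ≡⟨ ∑-cong 𝒫 (λ U → trans (cong (_ℕ* f U) (∣∣≡∑ U)) (sym (∑-*ʳ Vs (f U) (ι ∘ lookup U)))) ⟩
  ∑[ U ∈ 𝒫 ] ∑[ v ∈ Vs ] (ι (lookup U v) ℕ* f U)
    ≡⟨ ∑-comm 𝒫 Vs _ ⟩
  ∑[ v ∈ Vs ] ∑[ U ∈ 𝒫 ] (ι (lookup U v) ℕ* f U)
    ≡⟨ ∑-cong Vs (λ v → ∑-allSubsets-[]≔true n v f) ⟩
  ∑[ v ∈ Vs ] ∑[ U ∈ 𝒫 ] (ι (not (lookup U v)) ℕ* f (U [ v ]≔ true))
    ≡⟨ ∑-cong Vs (λ v → ∑-cong 𝒫 (λ U → grow U v (lookup U v) refl)) ⟩
  ∑[ v ∈ Vs ] ∑[ U ∈ 𝒫 ] (ι (∣ U ∣ ≡ᵇ k) ℕ* (ι (not (lookup U v)) ℕ* g (U [ v ]≔ true)))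
    ≡⟨ ∑-comm Vs 𝒫 _ ⟩
  ∑[ U ∈ 𝒫 ] ∑[ v ∈ Vs ] (ι (∣ U ∣ ≡ᵇ k) ℕ* (ι (not (lookup U v)) ℕ* g (U [ v ]≔ true)))
    ≡⟨ ∑-cong 𝒫 (λ U → ∑-*ˡ Vs (ι (∣ U ∣ ≡ᵇ k)) _) ⟩
  ∑[ U ∈ 𝒫 ] (ι (∣ U ∣ ≡ᵇ k) ℕ* ∑[ v ∈ Vs ] (ι (not (lookup U v)) ℕ* g (U [ v ]≔ true))) ∎
  where
  open ≡-Reasoning
  𝒫  = allSubsets n
  Vs = allFin n
  f : Subset n → ℕ
  f U = ι (∣ U ∣ ≡ᵇ suc k) ℕ* g U
  grow : ∀ U v b → lookup U v ≡ b →
         ι (not b) ℕ* f (U [ v ]≔ true) ≡ ι (∣ U ∣ ≡ᵇ k) ℕ* (ι (not b) ℕ* g (U [ v ]≔ true))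
  grow U v true  _   = sym (ℕ.*-zeroʳ (ι (∣ U ∣ ≡ᵇ k)))
  grow U v false v∉U rewrite ∣[]≔true∣ U v v∉U =
    trans (ℕ.*-identityˡ _) (cong (ι (∣ U ∣ ≡ᵇ k) ℕ*_) (sym (ℕ.*-identityˡ _)))

==-subsetᵇ : ∀ {n} (S T : Subset n) → (S == T) ≡ subsetᵇ T S ∧ subsetᵇ S T
==-subsetᵇ {n} S T =
  trans (all-cong (allFin n) (λ w → pointwise (lookup S w) (lookup T w))) (all-∧ _ _ (allFin n))
  where
  pointwise : ∀ s t → ⌊ s Boolₚ.≟ t ⌋ ≡ (not t ∨ s) ∧ (not s ∨ t)
  pointwise false false = refl
  pointwise false true  = refl
  pointwise true  false = refl
  pointwise true  true  = refl

minus-==-subsetᵇ : ∀ {n} (S X T : Subset n) →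
  (minus S X == T) ≡ subsetᵇ T S ∧ (subsetᵇ (minus S T) X ∧ disjointᵇ T X)
minus-==-subsetᵇ {n} S X T = begin
  (minus S X == T)
    ≡⟨ all-cong (allFin n) (λ w → trans (cong (λ b → ⌊ b Boolₚ.≟ lookup T w ⌋) (lookup-minus S X w))
                                        (pointwise w (lookup S w) (lookup X w) (lookup T w) (lookup-minus S T w))) ⟩
  all (λ w → (not (lookup T w) ∨ lookup S w)
             ∧ ((not (lookup (minus S T) w) ∨ lookup X w) ∧ (not (lookup T w) ∨ not (lookup X w)))) (allFin n)
    ≡⟨ all-∧ _ _ (allFin n) ⟩
  subsetᵇ T S
    ∧ all (λ w → (not (lookup (minus S T) w) ∨ lookup X w) ∧ (not (lookup T w) ∨ not (lookup X w))) (allFin n)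
    ≡⟨ cong (subsetᵇ T S ∧_) (all-∧ _ _ (allFin n)) ⟩
  subsetᵇ T S ∧ (subsetᵇ (minus S T) X ∧ disjointᵇ T X) ∎
  where
  open ≡-Reasoning
  pointwise : ∀ w s x t → lookup (minus S T) w ≡ s ∧ not t →
              ⌊ s ∧ not x Boolₚ.≟ t ⌋ ≡ (not t ∨ s) ∧ ((not (lookup (minus S T) w) ∨ x) ∧ (not t ∨ not x))
  pointwise w s x t m rewrite m with s | x | t
  ... | false | false | false = refl
  ... | false | false | true  = refl
  ... | false | true  | false = refl
  ... | false | true  | true  = refl
  ... | true  | false | false = refl
  ... | true  | false | true  = refl
  ... | true  | true  | false = refl
  ... | true  | true  | true  = refl

==⇒minus-subsetᵇ : ∀ {n} (S T X : Subset n) → Bool.T (S == T) → Bool.T (subsetᵇ (minus S T) X)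
==⇒minus-subsetᵇ {n} S T X = all-mono pointwise (allFin n)
  where
  pointwise : ∀ w → Bool.T ⌊ lookup S w Boolₚ.≟ lookup T w ⌋ → Bool.T (not (lookup (minus S T) w) ∨ lookup X w)
  pointwise w s≡t rewrite lookup-minus S T w with lookup S w | lookup T w
  ... | false | _     = _
  ... | true  | true  = _

ι-∧-not-identity : ∀ p q c d → (Bool.T (p ∧ q) → Bool.T c) →
  ι (p ∧ (c ∧ d)) ℕ+ ι (not d) ℕ* ι (p ∧ q) ≡ ι (p ∧ not q) ℕ* ι (c ∧ d) ℕ+ ι (p ∧ q)
ι-∧-not-identity false q     c     d     _     = ℕ.*-zeroʳ (ι (not d))
ι-∧-not-identity true  false false false _     = refl
ι-∧-not-identity true  false false true  _     = refl
ι-∧-not-identity true  false true  false _     = refl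
ι-∧-not-identity true  false true  true  _     = refl
ι-∧-not-identity true  true  false d     p∧q⇒c = ⊥-elim (p∧q⇒c _)
ι-∧-not-identity true  true  true  false _     = refl
ι-∧-not-identity true  true  true  true  _     = refl

ι-minus-== : ∀ {n} (S X T : Subset n) →
  ι (minus S X == T) ℕ+ ι (not (disjointᵇ T X)) ℕ* ι (S == T)
    ≡ ι (properSubsetᵇ T S) ℕ* ι (subsetᵇ (minus S T) X ∧ disjointᵇ T X) ℕ+ ι (S == T)
ι-minus-== S X T
  rewrite minus-==-subsetᵇ S X T | ==-subsetᵇ S T =
  ι-∧-not-identity (subsetᵇ T S) (subsetᵇ S T) (subsetᵇ (minus S T) X) (disjointᵇ T X)
    (λ S≡T → ==⇒minus-subsetᵇ S T X (subst Bool.T (sym (==-subsetᵇ S T)) S≡T))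

module _ {n : ℕ} (G : Graph n) where

  N[_] : Fin n → Subset n
  N[ v ] = N G (singleton v)

  undominated : Subset n → Subset n
  undominated U = compl (N G U)

  closedAdj-sym : ∀ u w → closedAdj G u w ≡ closedAdj G w u
  closedAdj-sym u w = cong₂ _∨_ (⌊≟⌋-sym u w) (symmetric G u w)

  lookup-N : ∀ U w → lookup (N G U) w ≡ domV G U w
  lookup-N U w = Vecₚ.lookup∘tabulate (domV G U) w

  domV-singleton : ∀ v w → domV G (singleton v) w ≡ closedAdj G v w
  domV-singleton v w = T-ext from-witness to-witness
    where
    from-witness : Bool.T (domV G (singleton v) w) → Bool.T (closedAdj G v w)
    from-witness v⊢w with T-any-allFin⁻ _ v⊢w
    ... | u , u∈v∧u⊢w with Equivalence.to Boolₚ.T-∧ u∈v∧u⊢w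
    ...   | u∈v , u⊢w rewrite toWitness (subst Bool.T (lookup-singleton v u) u∈v) = u⊢w
    to-witness : Bool.T (closedAdj G v w) → Bool.T (domV G (singleton v) w)
    to-witness v⊢w = T-any-allFin⁺ _ v
      (Equivalence.from Boolₚ.T-∧ (subst Bool.T (sym (lookup-singleton v v)) (fromWitness refl) , v⊢w))

  lookup-N[] : ∀ v w → lookup N[ v ] w ≡ closedAdj G v w
  lookup-N[] v w = trans (lookup-N (singleton v) w) (domV-singleton v w)

  domV-[]≔true : ∀ U v w → domV G (U [ v ]≔ true) w ≡ domV G U w ∨ closedAdj G v w
  domV-[]≔true U v w = begin
    any (λ u → lookup (U [ v ]≔ true) u ∧ closedAdj G u w) (allFin n)
      ≡⟨ any-cong (allFin n) (λ u →
           trans (cong (_∧ closedAdj G u w) (lookup-[]≔true U v u))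
                 (Boolₚ.∧-distribʳ-∨ (closedAdj G u w) (lookup U u) (lookup (singleton v) u))) ⟩
    any (λ u → lookup U u ∧ closedAdj G u w ∨ lookup (singleton v) u ∧ closedAdj G u w) (allFin n)
      ≡⟨ any-∨ _ _ (allFin n) ⟩
    domV G U w ∨ domV G (singleton v) w
      ≡⟨ cong (domV G U w ∨_) (domV-singleton v w) ⟩
    domV G U w ∨ closedAdj G v w ∎
    where open ≡-Reasoning

  domS≡subsetᵇ-N : ∀ U W → domS G U W ≡ subsetᵇ W (N G U)
  domS≡subsetᵇ-N U W = all-cong (allFin n) (λ w → cong (not (lookup W w) ∨_) (sym (lookup-N U w)))

  domNone≡disjointᵇ-N : ∀ U S → domNone G U S ≡ disjointᵇ S (N G U)
  domNone≡disjointᵇ-N U S = all-cong (allFin n) (λ w → cong (λ b → not (lookup S w) ∨ not b) (sym (lookup-N U w)))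

  dominatesExactly≡undominated-== : ∀ U S → domS G U (compl S) ∧ domNone G U S ≡ (undominated U == S)
  dominatesExactly≡undominated-== U S = begin
    domS G U (compl S) ∧ domNone G U S
      ≡⟨ all-∧ _ _ (allFin n) ⟨
    all (λ w → (not (lookup (compl S) w) ∨ domV G U w) ∧ (not (lookup S w) ∨ not (domV G U w))) (allFin n)
      ≡⟨ all-cong (allFin n) pointwise ⟩
    (undominated U == S) ∎
    where
    open ≡-Reasoning
    exactly : ∀ s d → (not (not s) ∨ d) ∧ (not s ∨ not d) ≡ ⌊ not d Boolₚ.≟ s ⌋
    exactly false false = refl
    exactly false true  = refl
    exactly true  false = refl
    exactly true  true  = refl
    pointwise : ∀ w → (not (lookup (compl S) w) ∨ domV G U w) ∧ (not (lookup S w) ∨ not (domV G U w))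
                    ≡ ⌊ lookup (undominated U) w Boolₚ.≟ lookup S w ⌋
    pointwise w rewrite lookup-compl S w | lookup-compl (N G U) w | lookup-N U w = exactly (lookup S w) (domV G U w)

  undominated-[]≔true : ∀ U v → undominated (U [ v ]≔ true) ≡ minus (undominated U) N[ v ]
  undominated-[]≔true U v = ≡-from-lookup λ w → begin
    lookup (undominated (U [ v ]≔ true)) w          ≡⟨ lookup-compl (N G (U [ v ]≔ true)) w ⟩
    not (lookup (N G (U [ v ]≔ true)) w)            ≡⟨ cong not (trans (lookup-N (U [ v ]≔ true) w) (domV-[]≔true U v w)) ⟩
    not (domV G U w ∨ closedAdj G v w)              ≡⟨ deMorgan₂ (domV G U w) (closedAdj G v w) ⟩
    not (domV G U w) ∧ not (closedAdj G v w)        ≡⟨ cong₂ (λ a b → not a ∧ not b) (lookup-N U w)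
                                                            (lookup-N[] v w) ⟨
    not (lookup (N G U) w) ∧ not (lookup N[ v ] w)
                                                    ≡⟨ cong (_∧ not (lookup N[ v ] w)) (lookup-compl (N G U) w) ⟨
    lookup (undominated U) w ∧ not (lookup N[ v ] w)
                                                    ≡⟨ lookup-minus (undominated U) N[ v ] w ⟨
    lookup (minus (undominated U) N[ v ]) w ∎
    where open ≡-Reasoning

  minus-N[]-of-member : ∀ U v → lookup U v ≡ true → minus (undominated U) N[ v ] ≡ undominated U
  minus-N[]-of-member U v v∈U = ≡-from-lookup λ w → begin
    lookup (minus (undominated U) N[ v ]) w
      ≡⟨ lookup-minus (undominated U) N[ v ] w ⟩
    lookup (undominated U) w ∧ not (lookup N[ v ] w)
      ≡⟨ cong (λ b → lookup (undominated U) w ∧ not b) (lookup-N[] v w) ⟩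
    lookup (undominated U) w ∧ not (closedAdj G v w)
      ≡⟨ absorb w (closedAdj G v w) refl ⟩
    lookup (undominated U) w ∎
    where
    open ≡-Reasoning
    absorb : ∀ w c → closedAdj G v w ≡ c → lookup (undominated U) w ∧ not c ≡ lookup (undominated U) w
    absorb w false _   = Boolₚ.∧-identityʳ _
    absorb w true  v⊢w = begin
      lookup (undominated U) w ∧ false ≡⟨ Boolₚ.∧-zeroʳ _ ⟩
      false                            ≡⟨ cong not (trans (lookup-N U w) U⊢w) ⟨
      not (lookup (N G U) w)           ≡⟨ lookup-compl (N G U) w ⟨
      lookup (undominated U) w         ∎
      where
      U⊢w : domV G U w ≡ true
      U⊢w = Equivalence.to Boolₚ.T-≡ (T-any-allFin⁺ _ v
        (Equivalence.from Boolₚ.T-∧ (Equivalence.from Boolₚ.T-≡ v∈U , Equivalence.from Boolₚ.T-≡ v⊢w)))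

  domV≡not-disjointᵇ-N[] : ∀ T v → domV G T v ≡ not (disjointᵇ T N[ v ])
  domV≡not-disjointᵇ-N[] T v = trans (any≡not-all-not _ (allFin n)) (cong not (all-cong (allFin n) pointwise))
    where
    pointwise : ∀ t → not (lookup T t ∧ closedAdj G t v) ≡ not (lookup T t) ∨ not (lookup N[ v ] t)
    pointwise t = begin
      not (lookup T t ∧ closedAdj G t v)            ≡⟨ deMorgan₁ (lookup T t) (closedAdj G t v) ⟩
      not (lookup T t) ∨ not (closedAdj G t v)      ≡⟨ cong (λ b → not (lookup T t) ∨ not b) (closedAdj-sym t v) ⟩
      not (lookup T t) ∨ not (closedAdj G v t)      ≡⟨ cong (λ b → not (lookup T t) ∨ not b)
                                                            (lookup-N[] v t) ⟨
      not (lookup T t) ∨ not (lookup N[ v ] t) ∎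
      where open ≡-Reasoning

  E-as-∑ : ∀ j S → E G j S ≡ ∑[ U ∈ allSubsets n ] (ι (∣ U ∣ ≡ᵇ j) ℕ* ι (undominated U == S))
  E-as-∑ j S = trans (length-filterᵇ _ (allSubsets n)) (∑-cong (allSubsets n) λ U →
    trans (ι-∧ (∣ U ∣ ≡ᵇ j) _) (cong (λ b → ι (∣ U ∣ ≡ᵇ j) ℕ* ι b) (dominatesExactly≡undominated-== U S)))

  D-as-∑ : ∀ S T → D G S T ≡ ∑[ v ∈ allFin n ] ι (subsetᵇ (minus S T) N[ v ] ∧ disjointᵇ T N[ v ])
  D-as-∑ S T = trans (length-filterᵇ _ (allFin n)) (∑-cong (allFin n) λ v →
    cong ι (cong₂ _∧_ (domS≡subsetᵇ-N (singleton v) (minus S T)) (domNone≡disjointᵇ-N (singleton v) T)))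

  ∣N∣-as-∑ : ∀ T → ∣ N G T ∣ ≡ ∑[ v ∈ allFin n ] ι (not (disjointᵇ T N[ v ]))
  ∣N∣-as-∑ T = trans (∣∣≡∑ (N G T)) (∑-cong (allFin n) λ v →
    cong ι (trans (lookup-N T v) (domV≡not-disjointᵇ-N[] T v)))

  ι-[]≔true-== : ∀ U v T →
    ι (not (lookup U v)) ℕ* ι (undominated (U [ v ]≔ true) == T) ℕ+ ι (lookup U v) ℕ* ι (undominated U == T)
      ≡ ι (minus (undominated U) N[ v ] == T)
  ι-[]≔true-== U v T with lookup U v in v∈U
  ... | true  rewrite minus-N[]-of-member U v v∈U = ℕ.+-identityʳ _
  ... | false rewrite undominated-[]≔true U v = trans (ℕ.+-identityʳ _) (ℕ.+-identityʳ _)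

  vertex-identity : ∀ U T v →
    ι (not (lookup U v)) ℕ* ι (undominated (U [ v ]≔ true) == T)
      ℕ+ (ι (lookup U v) ℕ+ ι (not (disjointᵇ T N[ v ]))) ℕ* ι (undominated U == T)
    ≡ ι (properSubsetᵇ T (undominated U)) ℕ* ι (subsetᵇ (minus (undominated U) T) N[ v ] ∧ disjointᵇ T N[ v ])
      ℕ+ ι (undominated U == T)
  vertex-identity U T v = begin
    a ℕ+ (b ℕ+ c) ℕ* e
      ≡⟨ cong (a ℕ+_) (ℕ.*-distribʳ-+ e b c) ⟩
    a ℕ+ (b ℕ* e ℕ+ c ℕ* e)
      ≡⟨ ℕ.+-assoc a (b ℕ* e) (c ℕ* e) ⟨
    a ℕ+ b ℕ* e ℕ+ c ℕ* e
      ≡⟨ cong (_ℕ+ c ℕ* e) (ι-[]≔true-== U v T) ⟩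
    ι (minus (undominated U) N[ v ] == T) ℕ+ c ℕ* e
      ≡⟨ ι-minus-== (undominated U) N[ v ] T ⟩
    ι (properSubsetᵇ T (undominated U)) ℕ* ι (subsetᵇ (minus (undominated U) T) N[ v ] ∧ disjointᵇ T N[ v ]) ℕ+ e ∎
    where
    open ≡-Reasoning
    a = ι (not (lookup U v)) ℕ* ι (undominated (U [ v ]≔ true) == T)
    b = ι (lookup U v)
    c = ι (not (disjointᵇ T N[ v ]))
    e = ι (undominated U == T)

  subset-identity : ∀ U T →
    ∑[ v ∈ allFin n ] (ι (not (lookup U v)) ℕ* ι (undominated (U [ v ]≔ true) == T))
      ℕ+ (∣ U ∣ ℕ+ ∣ N G T ∣) ℕ* ι (undominated U == T)
    ≡ ι (properSubsetᵇ T (undominated U)) ℕ* D G (undominated U) T ℕ+ n ℕ* ι (undominated U == T)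
  subset-identity U T = begin
    ∑ Vs a ℕ+ (∣ U ∣ ℕ+ ∣ N G T ∣) ℕ* e
      ≡⟨ cong (λ m → ∑ Vs a ℕ+ m ℕ* e) (cong₂ _ℕ+_ (∣∣≡∑ U) (∣N∣-as-∑ T)) ⟩
    ∑ Vs a ℕ+ (∑ Vs b ℕ+ ∑ Vs c) ℕ* e
      ≡⟨ cong (λ m → ∑ Vs a ℕ+ m ℕ* e) (∑-+ Vs b c) ⟨
    ∑ Vs a ℕ+ ∑[ v ∈ Vs ] (b v ℕ+ c v) ℕ* e
      ≡⟨ cong (∑ Vs a ℕ+_) (∑-*ʳ Vs e (λ v → b v ℕ+ c v)) ⟨
    ∑ Vs a ℕ+ ∑[ v ∈ Vs ] ((b v ℕ+ c v) ℕ* e)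
      ≡⟨ ∑-+ Vs a (λ v → (b v ℕ+ c v) ℕ* e) ⟨
    ∑[ v ∈ Vs ] (a v ℕ+ (b v ℕ+ c v) ℕ* e)
      ≡⟨ ∑-cong Vs (vertex-identity U T) ⟩
    ∑[ v ∈ Vs ] (p ℕ* d v ℕ+ e)
      ≡⟨ ∑-+ Vs (λ v → p ℕ* d v) (λ _ → e) ⟩
    ∑[ v ∈ Vs ] (p ℕ* d v) ℕ+ ∑[ v ∈ Vs ] e
      ≡⟨ cong₂ _ℕ+_ (∑-*ˡ Vs p d) (∑-allFin-const n e) ⟩
    p ℕ* ∑ Vs d ℕ+ n ℕ* e
      ≡⟨ cong (λ m → p ℕ* m ℕ+ n ℕ* e) (D-as-∑ (undominated U) T) ⟨
    p ℕ* D G (undominated U) T ℕ+ n ℕ* e ∎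
    where
    open ≡-Reasoning
    Vs = allFin n
    e = ι (undominated U == T)
    p = ι (properSubsetᵇ T (undominated U))
    a b c d : Fin n → ℕ
    a v = ι (not (lookup U v)) ℕ* ι (undominated (U [ v ]≔ true) == T)
    b v = ι (lookup U v)
    c v = ι (not (disjointᵇ T N[ v ]))
    d v = ι (subsetᵇ (minus (undominated U) T) N[ v ] ∧ disjointᵇ T N[ v ])

  module _ (T : Subset n) (k : ℕ) where

    private
      𝒫 : List (Subset n)
      𝒫 = allSubsets n
      χ : Subset n → ℕ
      χ U = ι (undominated U == T)

    [k+1]E[k+1]-as-∑ : suc k ℕ* E G (suc k) T
      ≡ ∑[ U ∈ 𝒫 ] (ι (∣ U ∣ ≡ᵇ k) ℕ* ∑[ v ∈ allFin n ] (ι (not (lookup U v)) ℕ* χ (U [ v ]≔ true)))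
    [k+1]E[k+1]-as-∑ = trans (cong (suc k ℕ*_) (E-as-∑ (suc k) T)) (∑-card-suc n k χ)

    [k+N]E-as-∑ : (k ℕ+ ∣ N G T ∣) ℕ* E G k T ≡ ∑[ U ∈ 𝒫 ] (ι (∣ U ∣ ≡ᵇ k) ℕ* ((∣ U ∣ ℕ+ ∣ N G T ∣) ℕ* χ U))
    [k+N]E-as-∑ = begin
      (k ℕ+ ∣ N G T ∣) ℕ* E G k T
        ≡⟨ cong ((k ℕ+ ∣ N G T ∣) ℕ*_) (E-as-∑ k T) ⟩
      (k ℕ+ ∣ N G T ∣) ℕ* ∑[ U ∈ 𝒫 ] (ι (∣ U ∣ ≡ᵇ k) ℕ* χ U)
        ≡⟨ ∑-*-inner 𝒫 (k ℕ+ ∣ N G T ∣) (λ U → ι (∣ U ∣ ≡ᵇ k)) χ ⟩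
      ∑[ U ∈ 𝒫 ] (ι (∣ U ∣ ≡ᵇ k) ℕ* ((k ℕ+ ∣ N G T ∣) ℕ* χ U))
        ≡⟨ ∑-cong 𝒫 (λ U → ι-≡ᵇ-subst (λ i → (i ℕ+ ∣ N G T ∣) ℕ* χ U) ∣ U ∣ k) ⟩
      ∑[ U ∈ 𝒫 ] (ι (∣ U ∣ ≡ᵇ k) ℕ* ((∣ U ∣ ℕ+ ∣ N G T ∣) ℕ* χ U)) ∎
      where open ≡-Reasoning

    nE-as-∑ : n ℕ* E G k T ≡ ∑[ U ∈ 𝒫 ] (ι (∣ U ∣ ≡ᵇ k) ℕ* (n ℕ* χ U))
    nE-as-∑ = trans (cong (n ℕ*_) (E-as-∑ k T)) (∑-*-inner 𝒫 n (λ U → ι (∣ U ∣ ≡ᵇ k)) χ)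

    sumOverSupersets-as-∑ : sumOverSupersets G k T
      ≡ ∑[ U ∈ 𝒫 ] (ι (∣ U ∣ ≡ᵇ k) ℕ* (ι (properSubsetᵇ T (undominated U)) ℕ* D G (undominated U) T))
    sumOverSupersets-as-∑ = begin
      sumOverSupersets G k T
        ≡⟨ foldr-+-filterᵇ (properSubsetᵇ T) (λ S → E G k S ℕ* D G S T) 𝒫 ⟩
      ∑[ S ∈ 𝒫 ] (ι (properSubsetᵇ T S) ℕ* (E G k S ℕ* D G S T))
        ≡⟨ ∑-cong 𝒫 (λ S → *-CS.x∙yz≈y∙xz (ι (properSubsetᵇ T S)) (E G k S) (D G S T)) ⟩
      ∑[ S ∈ 𝒫 ] (E G k S ℕ* h S)
        ≡⟨ ∑-cong 𝒫 (λ S → cong (_ℕ* h S) (E-as-∑ k S)) ⟩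
      ∑[ S ∈ 𝒫 ] (∑[ U ∈ 𝒫 ] (ι (∣ U ∣ ≡ᵇ k) ℕ* ι (undominated U == S)) ℕ* h S)
        ≡⟨ ∑-cong 𝒫 (λ S → sym (∑-*ʳ 𝒫 (h S) _)) ⟩
      ∑[ S ∈ 𝒫 ] ∑[ U ∈ 𝒫 ] (ι (∣ U ∣ ≡ᵇ k) ℕ* ι (undominated U == S) ℕ* h S)
        ≡⟨ ∑-comm 𝒫 𝒫 _ ⟩
      ∑[ U ∈ 𝒫 ] ∑[ S ∈ 𝒫 ] (ι (∣ U ∣ ≡ᵇ k) ℕ* ι (undominated U == S) ℕ* h S)
        ≡⟨ ∑-cong 𝒫 (λ U → ∑-cong 𝒫 (λ S → ℕ.*-assoc (ι (∣ U ∣ ≡ᵇ k)) _ (h S))) ⟩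
      ∑[ U ∈ 𝒫 ] ∑[ S ∈ 𝒫 ] (ι (∣ U ∣ ≡ᵇ k) ℕ* (ι (undominated U == S) ℕ* h S))
        ≡⟨ ∑-cong 𝒫 (λ U → ∑-*ˡ 𝒫 (ι (∣ U ∣ ≡ᵇ k)) _) ⟩
      ∑[ U ∈ 𝒫 ] (ι (∣ U ∣ ≡ᵇ k) ℕ* ∑[ S ∈ 𝒫 ] (ι (undominated U == S) ℕ* h S))
        ≡⟨ ∑-cong 𝒫 (λ U → cong (ι (∣ U ∣ ≡ᵇ k) ℕ*_) (∑-allSubsets-== n (undominated U) h)) ⟩
      ∑[ U ∈ 𝒫 ] (ι (∣ U ∣ ≡ᵇ k) ℕ* h (undominated U)) ∎
      where
      open ≡-Reasoning
      h : Subset n → ℕ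
      h S = ι (properSubsetᵇ T S) ℕ* D G S T

    double-counting :
      suc k ℕ* E G (suc k) T ℕ+ (k ℕ+ ∣ N G T ∣) ℕ* E G k T ≡ sumOverSupersets G k T ℕ+ n ℕ* E G k T
    double-counting = begin
      suc k ℕ* E G (suc k) T ℕ+ (k ℕ+ ∣ N G T ∣) ℕ* E G k T
        ≡⟨ cong₂ _ℕ+_ [k+1]E[k+1]-as-∑ [k+N]E-as-∑ ⟩
      ∑[ U ∈ 𝒫 ] (w U ℕ* a U) ℕ+ ∑[ U ∈ 𝒫 ] (w U ℕ* b U)
        ≡⟨ ∑-*-+ 𝒫 w a b ⟩
      ∑[ U ∈ 𝒫 ] (w U ℕ* (a U ℕ+ b U))
        ≡⟨ ∑-cong 𝒫 (λ U → cong (w U ℕ*_) (subset-identity U T)) ⟩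
      ∑[ U ∈ 𝒫 ] (w U ℕ* (c U ℕ+ d U))
        ≡⟨ ∑-*-+ 𝒫 w c d ⟨
      ∑[ U ∈ 𝒫 ] (w U ℕ* c U) ℕ+ ∑[ U ∈ 𝒫 ] (w U ℕ* d U)
        ≡⟨ cong₂ _ℕ+_ sumOverSupersets-as-∑ nE-as-∑ ⟨
      sumOverSupersets G k T ℕ+ n ℕ* E G k T ∎
      where
      open ≡-Reasoning
      w a b c d : Subset n → ℕ
      w U = ι (∣ U ∣ ≡ᵇ k)
      a U = ∑[ v ∈ allFin n ] (ι (not (lookup U v)) ℕ* χ (U [ v ]≔ true))
      b U = (∣ U ∣ ℕ+ ∣ N G T ∣) ℕ* χ U
      c U = ι (properSubsetᵇ T (undominated U)) ℕ* D G (undominated U) T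
      d U = n ℕ* χ U

ℕ-identity⇒ℤ-identity : ∀ n k m s e₀ e₁ → suc k ℕ* e₁ ℕ+ (k ℕ+ m) ℕ* e₀ ≡ s ℕ+ n ℕ* e₀ →
  + suc k * (+ e₁ - + e₀) ≡ + s - (+ (2 ℕ* k ℕ+ 1) + + m - + n) * + e₀
ℕ-identity⇒ℤ-identity n k m s e₀ e₁ identity = begin
  + suc k * (+ e₁ - + e₀)
    ≡⟨ solve 4 (λ k m e₀ e₁ → (con (+ 1) :+ k) :* (e₁ :- e₀)
                := (con (+ 1) :+ k) :* e₁ :+ (k :+ m) :* e₀ :- (con (+ 2) :* k :+ con (+ 1) :+ m) :* e₀)
             refl (+ k) (+ m) (+ e₀) (+ e₁) ⟩
  + suc k * + e₁ + (+ k + + m) * + e₀ - (+ 2 * + k + + 1 + + m) * + e₀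
    ≡⟨ cong₂ (λ x y → x - (y + + m) * + e₀) ℤ-identity
             (sym (trans (pos-+ (2 ℕ* k) 1) (cong (_+ + 1) (pos-* 2 k)))) ⟩
  + s + + n * + e₀ - (+ (2 ℕ* k ℕ+ 1) + + m) * + e₀
    ≡⟨ solve 5 (λ c m n e₀ s → s :+ n :* e₀ :- (c :+ m) :* e₀ := s :- (c :+ m :- n) :* e₀)
             refl (+ (2 ℕ* k ℕ+ 1)) (+ m) (+ n) (+ e₀) (+ s) ⟩
  + s - (+ (2 ℕ* k ℕ+ 1) + + m - + n) * + e₀ ∎
  where
  open ≡-Reasoning
  ℤ-identity : + suc k * + e₁ + (+ k + + m) * + e₀ ≡ + s + + n * + e₀
  ℤ-identity = begin
    + suc k * + e₁ + (+ k + + m) * + e₀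
      ≡⟨ cong₂ (λ x y → x + y * + e₀) (pos-* (suc k) e₁) (pos-+ k m) ⟨
    + (suc k ℕ* e₁) + + (k ℕ+ m) * + e₀
      ≡⟨ cong (_+_ (+ (suc k ℕ* e₁))) (pos-* (k ℕ+ m) e₀) ⟨
    + (suc k ℕ* e₁) + + ((k ℕ+ m) ℕ* e₀)
      ≡⟨ pos-+ (suc k ℕ* e₁) _ ⟨
    + (suc k ℕ* e₁ ℕ+ (k ℕ+ m) ℕ* e₀)
      ≡⟨ cong +_ identity ⟩
    + (s ℕ+ n ℕ* e₀)
      ≡⟨ pos-+ s _ ⟩
    + s + + (n ℕ* e₀)
      ≡⟨ cong (_+_ (+ s)) (pos-* n e₀) ⟩
    + s + + n * + e₀ ∎

lemma2p3 : (n : ℕ) (G : Graph n) (k : ℕ) → k ≤ n → (T : Subset n) → Nonempty T →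
    (+ suc k) * (+ E G (suc k) T - + E G k T)
      ≡ + sumOverSupersets G k T
        - (+ (2 ℕ* k ℕ+ 1) + + ∣ N G T ∣ - + n) * + E G k T
lemma2p3 n G k _ T _ =
  ℕ-identity⇒ℤ-identity n k ∣ N G T ∣ (sumOverSupersets G k T) (E G k T) (E G (suc k) T) (double-counting G T k)
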